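{- For a positive integer $k$ and a positive integer $n$ define $$S_k(n):=\frac12\sqrt{\frac{k}{12}}\sum_{\substack{x \bmod 24k\\ x^2\equiv -24n+1 \pmod{24k}}}\chi_{12}(x)\,e\!\left(\frac{x}{12k}\right),$$ where $\chi_{12}(x)=\left(\frac{12}{x}\right)$ is the Kronecker symbol and $e(y):=e^{2\pi i y}$. If $k$ is a power of $2$, then $S_k(n)\neq 0$ for all positive integers $n$. -}

module Defs where

open import Level using (Level)
open import Data.Nat using (ℕ; zero; suc; _+_; _*_; _∸_; _^_; _<_; _%_; NonZero)
open import Data.Nat.Divisibility using (_∣?_)
open import Data.List using (List; []; _∷_; upTo; foldr; map)
open import Data.Product using (_×_; ∃-syntax)
open import Relation.Nullary using (¬_; yes; no)
open import Algebra.Bundles using (CommutativeRing)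

private variable c ℓ : Level

-- χ₁₂(x) = (12/x), the Kronecker symbol; as a character mod 12 it is
--  1 if x ≡ ±1 (mod 12), -1 if x ≡ ±5 (mod 12), 0 otherwise.
data Sign : Set where
  plus minus nil : Sign

χ₁₂ : ℕ → Sign
χ₁₂ x with x % 12
... | 1  = plus
... | 11 = plus
... | 5  = minus
... | 7  = minus
... | _  = nil

module _ (R : CommutativeRing c ℓ) where
  open CommutativeRing R renaming (_+_ to _+ᴿ_; _*_ to _*ᴿ_)

  pow : Carrier → ℕ → Carrier
  pow z zero    = 1#
  pow z (suc m) = z *ᴿ pow z m

  cast : ℕ → Carrier
  cast zero    = 0#
  cast (suc m) = 1# +ᴿ cast m

  IsField : Set (c Level.⊔ ℓ)
  IsField = ¬ (1# ≈ 0#) × (∀ a → ¬ (a ≈ 0#) → ∃[ b ] (a *ᴿ b ≈ 1#))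

  CharZero : Set ℓ
  CharZero = ∀ m → ¬ (cast (suc m) ≈ 0#)

  PrimitiveRoot : ℕ → Carrier → Set ℓ
  PrimitiveRoot m ζ = (pow ζ m ≈ 1#) × (∀ d → 0 < d → d < m → ¬ (pow ζ d ≈ 1#))

  signed : Sign → Carrier → Carrier
  signed plus  a = a
  signed minus a = - a
  signed nil   a = 0#

  -- The sum  Σ_{x mod 24k, x² ≡ -24n+1 (mod 24k)} χ₁₂(x) ζ^x,
  -- x ranging over 0 ≤ x < 24k; ζ plays the role of e(1/(12k)).
  -- (x² ≡ 1 - 24n mod 24k  ⇔  24k ∣ x² + 24n - 1, with n ≥ 1.)
  term : ℕ → ℕ → Carrier → ℕ → Carrier
  term k n ζ x with (24 * k) ∣? (x * x + 24 * n ∸ 1)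
  ... | yes _ = signed (χ₁₂ x) (pow ζ x)
  ... | no  _ = 0#

  Ssum : ℕ → ℕ → Carrier → Carrier
  Ssum k n ζ = foldr _+ᴿ_ 0# (map (term k n ζ) (upTo (24 * k)))

  -- S_k(n) = ½ √(k/12) · Ssum, computed with ζ = e(1/(12k)) in ℂ.

module Submission where

-- Write k = 2^a, K = 4k and N = 12k = 3K, and let ζ be a primitive N-th root of unity.
-- Put ω = ζ^L with L = 2K², a primitive cube root of unity (K ∣ L and L ≡ 2 mod 3).
-- Since χ₁₂ = χ₄ χ₃ and (ω − ω²) χ₃(x) = ω^x − ω^(2x), multiplying the summand
-- χ₁₂(x) ζ^x by D = ω − ω² gives χ₄(x) (α^x − β^x) with α = ωζ and β = ω²ζ.
-- Here α^K = 1 while σ = β^K is a sixth root of unity different from 1.  Writing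
-- x = jK + c with j < 6, the summation over j therefore kills the β-part and
-- multiplies the α-part by 6.  The roots of x² ≡ 1 − 24n modulo 8k lying in [0, K)
-- are exactly some odd c₀ and K − c₀ (Hensel lifting and a difference of squares),
-- on which χ₄ takes opposite signs, so D·S = ±6 (α^c₀ − α^(K−c₀)).  If S = 0 then
-- α^(2c₀) = α^c₀ α^(K−c₀) = 1, i.e. N ∣ 2c₀(1 + L), impossible since c₀ and 1 + L
-- are odd while 4 ∣ N.

open import Defs
open import Level using (Level)
open import Data.Nat using (ℕ; _^_; _*_; _≤_)
open import Algebra.Bundles using (CommutativeRing)
open import Relation.Nullary using (¬_)

open import Data.Nat using (zero; suc; _+_; _∸_; _<_; _%_; _/_; z≤n; s≤s; NonZero)
import Data.Nat.Properties as ℕ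
open import Data.Nat.Divisibility
open import Data.Nat.DivMod
open import Data.Nat.Primality using (Prime; prime[2]; prime?; euclidsLemma)
open import Data.Nat.Tactic.RingSolver using (solve-∀)
open import Data.List using (foldr; applyUpTo)
open import Data.List.Properties using (map-applyUpTo)
open import Data.Product using (_×_; _,_; proj₁; proj₂; ∃-syntax)
import Data.Sum as Sum
open import Data.Sum using (_⊎_; inj₁; inj₂; [_,_]′)
open import Function.Base using (_∘_; id)
open import Function.Bundles using (_⇔_; mk⇔; Equivalence)
open import Relation.Nullary using (contradiction; yes; no)
open import Relation.Nullary.Decidable using (from-yes)
open import Relation.Binary.PropositionalEquality
  using (_≡_; _≢_; refl; sym; trans; cong; cong₂; subst; subst₂; module ≡-Reasoning)

-- Parity and divisibility

d∤r+k*d : ∀ {d} .{{_ : NonZero d}} {r} k → 0 < r → r < d → d ∤ r + k * d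
d∤r+k*d {d} {r} k 0<r r<d d∣ = ℕ.<⇒≢ 0<r (begin
  0                ≡⟨ n∣m⇒m%n≡0 _ d d∣ ⟨
  (r + k * d) % d  ≡⟨ [m+kn]%n≡m%n r k d ⟩
  r % d            ≡⟨ m<n⇒m%n≡m r<d ⟩
  r                ∎)
  where open ≡-Reasoning

Odd : ℕ → Set
Odd x = ∃[ t ] x ≡ 1 + 2 * t

even⊎odd : ∀ x → 2 ∣ x ⊎ Odd x
even⊎odd zero    = inj₁ (2 ∣0)
even⊎odd (suc x) with even⊎odd x
... | inj₁ (divides t refl) = inj₂ (t , cong suc (ℕ.*-comm t 2))
... | inj₂ (t , refl)       = inj₁ (divides (suc t) (lemma t))
  where
  lemma : ∀ t → 2 + 2 * t ≡ suc t * 2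
  lemma = solve-∀

odd⇒2∤ : ∀ {x} → Odd x → 2 ∤ x
odd⇒2∤ (t , refl) = subst (λ y → 2 ∤ 1 + y) (ℕ.*-comm t 2) (d∤r+k*d t (s≤s z≤n) (s≤s (s≤s z≤n)))

odd+even⇒odd : ∀ {x y} → Odd x → 2 ∣ y → Odd (x + y)
odd+even⇒odd (t , refl) (divides s refl) = t + s , lemma t s
  where
  lemma : ∀ t s → 1 + 2 * t + s * 2 ≡ 1 + 2 * (t + s)
  lemma = solve-∀

4∤[x+x]*y : ∀ {x y} → Odd x → Odd y → 4 ∤ (x + x) * y
4∤[x+x]*y (t , refl) (s , refl) =
  subst (4 ∤_) (sym (lemma t s)) (d∤r+k*d (t + s + 2 * t * s) (s≤s z≤n) (s≤s (s≤s (s≤s z≤n))))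
  where
  lemma : ∀ t s → (1 + 2 * t + (1 + 2 * t)) * (1 + 2 * s) ≡ 2 + (t + s + 2 * t * s) * 4
  lemma = solve-∀

2^∣odd*y⇒2^∣y : ∀ b {x y} → Odd x → 2 ^ b ∣ x * y → 2 ^ b ∣ y
2^∣odd*y⇒2^∣y zero    _ _ = 1∣ _
2^∣odd*y⇒2^∣y (suc b) {x} {y} x-odd 2^[1+b]∣xy
  with euclidsLemma x y prime[2] (m*n∣⇒m∣ 2 (2 ^ b) 2^[1+b]∣xy)
... | inj₁ 2∣x = contradiction 2∣x (odd⇒2∤ x-odd)
... | inj₂ (divides y′ refl) =
  subst (_∣ y′ * 2) (ℕ.*-comm (2 ^ b) 2) (*-monoˡ-∣ 2 (2^∣odd*y⇒2^∣y b x-odd 2^b∣xy′))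
  where
  lemma : ∀ x y′ → x * (y′ * 2) ≡ 2 * (x * y′)
  lemma = solve-∀
  2^b∣xy′ : 2 ^ b ∣ x * y′
  2^b∣xy′ = *-cancelˡ-∣ 2 (subst (2 * 2 ^ b ∣_) (lemma x y′) 2^[1+b]∣xy)

2∣x*[2u+x]⇒2∣x : ∀ {u x} → 2 ∣ x * (2 * u + x) → 2 ∣ x
2∣x*[2u+x]⇒2∣x {u} {x} 2∣ with euclidsLemma x (2 * u + x) prime[2] 2∣
... | inj₁ 2∣x    = 2∣x
... | inj₂ 2∣2u+x = ∣m+n∣m⇒∣n 2∣2u+x (m∣m*n u)

2^∣x*[u+x] : ∀ b {u x} → Odd u → 2 ^ b ∣ x * (u + x) → 2 ^ b ∣ x ⊎ 2 ^ b ∣ u + x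
2^∣x*[u+x] b {u} {x} u-odd 2^b∣ with even⊎odd x
... | inj₁ 2∣x   = inj₁ (2^∣odd*y⇒2^∣y b (odd+even⇒odd u-odd 2∣x) (subst (2 ^ b ∣_) (ℕ.*-comm x (u + x)) 2^b∣))
... | inj₂ x-odd = inj₂ (2^∣odd*y⇒2^∣y b x-odd 2^b∣)

2∣8*2^a : ∀ a → 2 ∣ 8 * 2 ^ a
2∣8*2^a a = divides (4 * 2 ^ a) (lemma (2 ^ a))
  where
  lemma : ∀ z → 8 * z ≡ 4 * z * 2
  lemma = solve-∀

∣∧<⇒≡0 : ∀ {m x} → m ∣ x → x < m → x ≡ 0
∣∧<⇒≡0     (divides 0       refl) _   = refl
∣∧<⇒≡0 {m} (divides (suc q) refl) x<m = contradiction (ℕ.m≤m+n m (q * m)) (ℕ.<⇒≱ x<m)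

∣∧<2*⇒≡ : ∀ {m x} → m ∣ x → 0 < x → x < 2 * m → x ≡ m
∣∧<2*⇒≡ {m} (divides 1 refl)             _ _    = ℕ.+-identityʳ m
∣∧<2*⇒≡ {m} (divides (suc (suc q)) refl) _ x<2m =
  contradiction (ℕ.+-monoʳ-≤ m (ℕ.+-monoʳ-≤ m z≤n)) (ℕ.<⇒≱ x<2m)

prime[3] : Prime 3
prime[3] = from-yes (prime? 3)

3∤2^ : ∀ b → 3 ∤ 2 ^ b
3∤2^ zero    = >⇒∤ (s≤s (s≤s z≤n))
3∤2^ (suc b) 3∣2^[1+b] with euclidsLemma 2 (2 ^ b) prime[3] 3∣2^[1+b]
... | inj₁ 3∣2   = >⇒∤ (s≤s (s≤s (s≤s z≤n))) 3∣2
... | inj₂ 3∣2^b = 3∤2^ b 3∣2^b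

3∣∧8*2^a∣⇒24*2^a∣ : ∀ a {y} → 3 ∣ y → 8 * 2 ^ a ∣ y → 24 * 2 ^ a ∣ y
3∣∧8*2^a∣⇒24*2^a∣ a 3∣y (divides q refl) with euclidsLemma q (8 * 2 ^ a) prime[3] 3∣y
... | inj₁ (divides q′ refl) = divides q′ (lemma q′ (2 ^ a))
  where
  lemma : ∀ q′ z → q′ * 3 * (8 * z) ≡ q′ * (24 * z)
  lemma = solve-∀
... | inj₂ 3∣8*2^a = contradiction (subst (3 ∣_) (lemma (2 ^ a)) 3∣8*2^a) (3∤2^ (3 + a))
  where
  lemma : ∀ z → 8 * z ≡ 2 * (2 * (2 * z))
  lemma = solve-∀

3∤x⇒3∣x*x+2 : ∀ {x} → 3 ∤ x → 3 ∣ x * x + 2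
3∤x⇒3∣x*x+2 {x} 3∤x with x % 3 | m≡m%n+[m/n]*n x 3 | m%n<n x 3
... | 0 | x≡ | _ = contradiction (divides (x / 3) x≡) 3∤x
... | 1 | x≡ | _ = divides (1 + 2 * q + 3 * q * q) (trans (cong (λ y → y * y + 2) x≡) (lemma q))
  where
  q = x / 3
  lemma : ∀ q → (1 + q * 3) * (1 + q * 3) + 2 ≡ (1 + 2 * q + 3 * q * q) * 3
  lemma = solve-∀
... | 2 | x≡ | _ = divides (2 + 4 * q + 3 * q * q) (trans (cong (λ y → y * y + 2) x≡) (lemma q))
  where
  q = x / 3
  lemma : ∀ q → (2 + q * 3) * (2 + q * 3) + 2 ≡ (2 + 4 * q + 3 * q * q) * 3
  lemma = solve-∀
... | suc (suc (suc _)) | _ | s≤s (s≤s (s≤s ()))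

3∤x⇒3∣1+2*x*x : ∀ {x} → 3 ∤ x → 3 ∣ 1 + 2 * (x * x)
3∤x⇒3∣1+2*x*x {x} 3∤x = ∣m+n∣m⇒∣n (subst (3 ∣_) (lemma x) (∣n⇒∣m*n 2 (3∤x⇒3∣x*x+2 3∤x))) ∣-refl
  where
  lemma : ∀ x → 2 * (x * x + 2) ≡ 3 + (1 + 2 * (x * x))
  lemma = solve-∀

3∤x⇒3∤1+4*x*x : ∀ {x} → 3 ∤ x → 3 ∤ 1 + 2 * (2 * (x * x))
3∤x⇒3∤1+4*x*x {x} 3∤x 3∣1+4x² =
  >⇒∤ (s≤s (s≤s z≤n)) (∣m+n∣m⇒∣n (subst (3 ∣_) (lemma x) (∣n⇒∣m*n 2 (3∤x⇒3∣1+2*x*x 3∤x))) 3∣1+4x²)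
  where
  lemma : ∀ x → 2 * (1 + 2 * (x * x)) ≡ (1 + 2 * (2 * (x * x))) + 1
  lemma = solve-∀

-- Square roots of −M modulo 8·2^a

SqrtNeg : ℕ → ℕ → ℕ → Set
SqrtNeg m M x = m ∣ x * x + M

module _ {M : ℕ} where

  8∣1+M⇒2∤M : 8 ∣ 1 + M → 2 ∤ M
  8∣1+M⇒2∤M 8∣1+M 2∣M =
    >⇒∤ (s≤s (s≤s z≤n)) (∣m+n∣m⇒∣n (subst (2 ∣_) (ℕ.+-comm 1 M) (∣-trans (divides 4 refl) 8∣1+M)) 2∣M)

  3∤x⇒3∣x*x+M : ∀ {x} → 3 ∣ 1 + M → 3 ∤ x → 3 ∣ x * x + M
  3∤x⇒3∣x*x+M {x} 3∣1+M 3∤x =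
    ∣m+n∣m⇒∣n (subst (3 ∣_) (lemma x M) (∣m∣n⇒∣m+n (3∤x⇒3∣x*x+2 3∤x) 3∣1+M)) ∣-refl
    where
    lemma : ∀ x M → (x * x + 2) + (1 + M) ≡ 3 + (x * x + M)
    lemma = solve-∀

  3∣x⇒3∤x*x+M : ∀ {x} → 3 ∣ 1 + M → 3 ∣ x → 3 ∤ x * x + M
  3∣x⇒3∤x*x+M {x} 3∣1+M 3∣x 3∣x*x+M =
    >⇒∤ (s≤s (s≤s z≤n)) (∣m+n∣m⇒∣n (subst (3 ∣_) (lemma x M) (∣m∣n⇒∣m+n (∣m⇒∣m*n x 3∣x) 3∣1+M)) 3∣x*x+M)
    where
    lemma : ∀ x M → x * x + (1 + M) ≡ (x * x + M) + 1
    lemma = solve-∀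

  sqrtNeg-odd : ∀ {m x} → 2 ∣ m → 2 ∤ M → SqrtNeg m M x → Odd x
  sqrtNeg-odd {m} {x} 2∣m 2∤M root with even⊎odd x
  ... | inj₂ x-odd = x-odd
  ... | inj₁ 2∣x   = contradiction (∣m+n∣m⇒∣n (∣-trans 2∣m root) (∣m⇒∣m*n x 2∣x)) 2∤M

  sqrtNeg-shift : ∀ a j c → SqrtNeg (8 * 2 ^ a) M (j * (4 * 2 ^ a) + c) ⇔ SqrtNeg (8 * 2 ^ a) M c
  sqrtNeg-shift a j c = mk⇔
    (λ root → ∣m+n∣m⇒∣n (subst (8 * 2 ^ a ∣_) expand root) (m∣m*n _))
    (λ root → subst (8 * 2 ^ a ∣_) (sym expand) (∣m∣n⇒∣m+n (m∣m*n _) root))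
    where
    lemma : ∀ j c z M → (j * (4 * z) + c) * (j * (4 * z) + c) + M ≡ 8 * z * (j * c + 2 * z * j * j) + (c * c + M)
    lemma = solve-∀
    expand = lemma j c (2 ^ a) M

  sqrtNeg-antipode : ∀ a {c c′} → c + c′ ≡ 4 * 2 ^ a → SqrtNeg (8 * 2 ^ a) M c → SqrtNeg (8 * 2 ^ a) M c′
  sqrtNeg-antipode a {c} {c′} c+c′≡K root =
    ∣m+n∣m⇒∣n (subst (8 * 2 ^ a ∣_) expand 8z∣lhs) (divides c (lemma₂ c (2 ^ a)))
    where
    lemma₁ : ∀ c c′ M → (c * c + M) + (c + c′) * (c + c′) ≡ 2 * (c + c′) * c + (c′ * c′ + M)
    lemma₁ = solve-∀
    lemma₂ : ∀ c z → 2 * (4 * z) * c ≡ c * (8 * z)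
    lemma₂ = solve-∀
    lemma₃ : ∀ z → 4 * z * (4 * z) ≡ 2 * z * (8 * z)
    lemma₃ = solve-∀
    expand : (c * c + M) + 4 * 2 ^ a * (4 * 2 ^ a) ≡ 2 * (4 * 2 ^ a) * c + (c′ * c′ + M)
    expand = subst (λ K → (c * c + M) + K * K ≡ 2 * K * c + (c′ * c′ + M)) c+c′≡K (lemma₁ c c′ M)
    8z∣lhs : 8 * 2 ^ a ∣ (c * c + M) + 4 * 2 ^ a * (4 * 2 ^ a)
    8z∣lhs = ∣m∣n⇒∣m+n root (divides (2 * 2 ^ a) (lemma₃ (2 ^ a)))

  -- Hensel lifting: keep c if the cofactor of 8·2^a is even, otherwise pass to c + 4·2^a.
  sqrtNeg-lift : ∀ a {c} → 2 ∤ M → c < 4 * 2 ^ a → SqrtNeg (8 * 2 ^ a) M c →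
                 ∃[ c′ ] c′ < 4 * 2 ^ suc a × SqrtNeg (8 * 2 ^ suc a) M c′
  sqrtNeg-lift a {c} 2∤M c<K root@(divides q c²+M≡)
    with even⊎odd q | sqrtNeg-odd {x = c} (2∣8*2^a a) 2∤M root
  ... | inj₁ (divides r refl) | _ =
    c , ℕ.<-≤-trans c<K (ℕ.*-monoʳ-≤ 4 (ℕ.m≤m+n (2 ^ a) _)) , divides r (trans c²+M≡ (lemma r (2 ^ a)))
    where
    lemma : ∀ r z → r * 2 * (8 * z) ≡ r * (8 * (2 * z))
    lemma = solve-∀
  ... | inj₂ (s , refl) | (t , refl) =
    c + 4 * z , subst (c + 4 * z <_) (lemma₁ z) (ℕ.+-monoˡ-< (4 * z) c<K) , divides (1 + s + t + z) (begin
      (1 + 2 * t + 4 * z) * (1 + 2 * t + 4 * z) + M                 ≡⟨ lemma₂ t z M ⟩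
      ((1 + 2 * t) * (1 + 2 * t) + M) + 8 * z * (1 + 2 * t + 2 * z) ≡⟨ cong (_+ 8 * z * (1 + 2 * t + 2 * z)) c²+M≡ ⟩
      (1 + 2 * s) * (8 * z) + 8 * z * (1 + 2 * t + 2 * z)           ≡⟨ lemma₃ s t z ⟩
      (1 + s + t + z) * (8 * (2 * z))                               ∎)
    where
    open ≡-Reasoning
    z = 2 ^ a
    lemma₁ : ∀ z → 4 * z + 4 * z ≡ 4 * (2 * z)
    lemma₁ = solve-∀
    lemma₂ : ∀ t z M → (1 + 2 * t + 4 * z) * (1 + 2 * t + 4 * z) + M ≡
                       ((1 + 2 * t) * (1 + 2 * t) + M) + 8 * z * (1 + 2 * t + 2 * z)
    lemma₂ = solve-∀
    lemma₃ : ∀ s t z → (1 + 2 * s) * (8 * z) + 8 * z * (1 + 2 * t + 2 * z) ≡ (1 + s + t + z) * (8 * (2 * z))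
    lemma₃ = solve-∀

  sqrtNeg-exists : 8 ∣ 1 + M → ∀ a → ∃[ c ] c < 4 * 2 ^ a × SqrtNeg (8 * 2 ^ a) M c
  sqrtNeg-exists 8∣1+M zero    = 1 , s≤s (s≤s z≤n) , 8∣1+M
  sqrtNeg-exists 8∣1+M (suc a) with sqrtNeg-exists 8∣1+M a
  ... | c , c<K , root = sqrtNeg-lift a (8∣1+M⇒2∤M 8∣1+M) c<K root

  2^∣square-difference : ∀ a {u d} → Odd u → 8 * 2 ^ a ∣ d * (2 * u + d) →
                         4 * 2 ^ a ∣ d ⊎ 4 * 2 ^ a ∣ 2 * u + d
  2^∣square-difference a {u} {d} u-odd 8z∣ with 2∣x*[2u+x]⇒2∣x {u} {d} (∣-trans (2∣8*2^a a) 8z∣)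
  ... | divides e refl =
    Sum.map double (subst (4 * 2 ^ a ∣_) (lemma₃ u e) ∘ double)
      (2^∣x*[u+x] (suc a) u-odd (*-cancelˡ-∣ 4 (subst₂ _∣_ (lemma₁ (2 ^ a)) (lemma₂ u e) 8z∣)))
    where
    lemma₁ : ∀ z → 8 * z ≡ 4 * (2 * z)
    lemma₁ = solve-∀
    lemma₂ : ∀ u e → e * 2 * (2 * u + e * 2) ≡ 4 * (e * (u + e))
    lemma₂ = solve-∀
    lemma₃ : ∀ u e → (u + e) * 2 ≡ 2 * u + e * 2
    lemma₃ = solve-∀
    lemma₄ : ∀ z → 2 * z * 2 ≡ 4 * z
    lemma₄ = solve-∀
    double : ∀ {y} → 2 * 2 ^ a ∣ y → 4 * 2 ^ a ∣ y * 2
    double {y} = subst (_∣ y * 2) (lemma₄ (2 ^ a)) ∘ *-monoˡ-∣ 2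

  sqrtNeg-unique-+ : ∀ a {c d} → Odd c → c + d < 4 * 2 ^ a →
                     SqrtNeg (8 * 2 ^ a) M c → SqrtNeg (8 * 2 ^ a) M (c + d) → d ≡ 0 ⊎ 2 * c + d ≡ 4 * 2 ^ a
  sqrtNeg-unique-+ a {c} {d} c-odd c+d<K root root′
    with 2^∣square-difference a c-odd (∣m+n∣m⇒∣n (subst (8 * 2 ^ a ∣_) (lemma c d M) root′) root)
    where
    lemma : ∀ c d M → (c + d) * (c + d) + M ≡ (c * c + M) + d * (2 * c + d)
    lemma = solve-∀
  ... | inj₁ K∣d    = inj₁ (∣∧<⇒≡0 K∣d (ℕ.≤-<-trans (ℕ.m≤n+m d c) c+d<K))
  ... | inj₂ K∣2c+d = inj₂ (∣∧<2*⇒≡ K∣2c+d 0<2c+d 2c+d<2K)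
    where
    0<2c+d : 0 < 2 * c + d
    0<2c+d = subst (λ c → 0 < 2 * c + d) (sym (proj₂ c-odd)) (s≤s z≤n)
    2c+d<2K : 2 * c + d < 2 * (4 * 2 ^ a)
    2c+d<2K = begin-strict
      2 * c + d       ≤⟨ ℕ.+-monoʳ-≤ (2 * c) (ℕ.m≤n*m d 2) ⟩
      2 * c + 2 * d   ≡⟨ ℕ.*-distribˡ-+ 2 c d ⟨
      2 * (c + d)     <⟨ ℕ.*-monoʳ-< 2 c+d<K ⟩
      2 * (4 * 2 ^ a) ∎
      where open ℕ.≤-Reasoning

  sqrtNeg-unique : ∀ a {c c′} → 2 ∤ M → c < 4 * 2 ^ a → c′ < 4 * 2 ^ a →
                   SqrtNeg (8 * 2 ^ a) M c → SqrtNeg (8 * 2 ^ a) M c′ → c′ ≡ c ⊎ c + c′ ≡ 4 * 2 ^ a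
  sqrtNeg-unique a {c} {c′} 2∤M c<K c′<K root root′ with ℕ.≤-total c c′
  ... | inj₁ c≤c′ with ℕ.m≤n⇒∃[o]m+o≡n c≤c′
  ...   | d , refl =
    Sum.map (λ d≡0 → trans (cong (c +_) d≡0) (ℕ.+-identityʳ c)) (trans (lemma c d))
      (sqrtNeg-unique-+ a (sqrtNeg-odd (2∣8*2^a a) 2∤M root) c′<K root root′)
    where
    lemma : ∀ c d → c + (c + d) ≡ 2 * c + d
    lemma = solve-∀
  sqrtNeg-unique a {c} {c′} 2∤M c<K c′<K root root′ | inj₂ c′≤c with ℕ.m≤n⇒∃[o]m+o≡n c′≤c
  ...   | d , refl =
    Sum.map (λ d≡0 → sym (trans (cong (c′ +_) d≡0) (ℕ.+-identityʳ c′))) (trans (lemma c′ d))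
      (sqrtNeg-unique-+ a (sqrtNeg-odd (2∣8*2^a a) 2∤M root′) c<K root′ root)
    where
    lemma : ∀ c′ d → c′ + d + c′ ≡ 2 * c′ + d
    lemma = solve-∀

-- The characters χ₄ and χ₃

_⊛_ : Sign → Sign → Sign
plus  ⊛ t     = t
minus ⊛ plus  = minus
minus ⊛ minus = plus
minus ⊛ nil   = nil
nil   ⊛ _     = nil

⊛-zeroʳ : ∀ s → s ⊛ nil ≡ nil
⊛-zeroʳ plus  = refl
⊛-zeroʳ minus = refl
⊛-zeroʳ nil   = refl

χ₄ : ℕ → Sign
χ₄ x with x % 4
... | 1 = plus
... | 3 = minus
... | _ = nil

χ₃ : ℕ → Sign
χ₃ x with x % 3
... | 1 = plus
... | 2 = minus
... | _ = nil

χ₄-% : ∀ x → χ₄ (x % 4) ≡ χ₄ x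
χ₄-% x rewrite m%n%n≡m%n x 4 ⦃ _ ⦄ = refl

χ₃-% : ∀ x → χ₃ (x % 3) ≡ χ₃ x
χ₃-% x rewrite m%n%n≡m%n x 3 ⦃ _ ⦄ = refl

χ₁₂-% : ∀ x → χ₁₂ (x % 12) ≡ χ₁₂ x
χ₁₂-% x rewrite m%n%n≡m%n x 12 ⦃ _ ⦄ = refl

χ₄-cong : ∀ {x y} → x % 4 ≡ y % 4 → χ₄ x ≡ χ₄ y
χ₄-cong {x} {y} x≡y = trans (sym (χ₄-% x)) (trans (cong χ₄ x≡y) (χ₄-% y))

χ₃-cong : ∀ {x y} → x % 3 ≡ y % 3 → χ₃ x ≡ χ₃ y
χ₃-cong {x} {y} x≡y = trans (sym (χ₃-% x)) (trans (cong χ₃ x≡y) (χ₃-% y))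

χ₁₂≡χ₄⊛χ₃-residue : ∀ r → r < 12 → χ₁₂ r ≡ χ₄ r ⊛ χ₃ r
χ₁₂≡χ₄⊛χ₃-residue 0  _ = refl
χ₁₂≡χ₄⊛χ₃-residue 1  _ = refl
χ₁₂≡χ₄⊛χ₃-residue 2  _ = refl
χ₁₂≡χ₄⊛χ₃-residue 3  _ = refl
χ₁₂≡χ₄⊛χ₃-residue 4  _ = refl
χ₁₂≡χ₄⊛χ₃-residue 5  _ = refl
χ₁₂≡χ₄⊛χ₃-residue 6  _ = refl
χ₁₂≡χ₄⊛χ₃-residue 7  _ = refl
χ₁₂≡χ₄⊛χ₃-residue 8  _ = refl
χ₁₂≡χ₄⊛χ₃-residue 9  _ = refl
χ₁₂≡χ₄⊛χ₃-residue 10 _ = refl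
χ₁₂≡χ₄⊛χ₃-residue 11 _ = refl
χ₁₂≡χ₄⊛χ₃-residue (suc (suc (suc (suc (suc (suc (suc (suc (suc (suc (suc (suc _))))))))))))
  (s≤s (s≤s (s≤s (s≤s (s≤s (s≤s (s≤s (s≤s (s≤s (s≤s (s≤s (s≤s ()))))))))))))

χ₁₂≡χ₄⊛χ₃ : ∀ x → χ₁₂ x ≡ χ₄ x ⊛ χ₃ x
χ₁₂≡χ₄⊛χ₃ x = begin
  χ₁₂ x                      ≡⟨ χ₁₂-% x ⟨
  χ₁₂ (x % 12)               ≡⟨ χ₁₂≡χ₄⊛χ₃-residue (x % 12) (m%n<n x 12) ⟩
  χ₄ (x % 12) ⊛ χ₃ (x % 12)  ≡⟨ cong₂ _⊛_ (χ₄-cong {x % 12} {x} (m∣n⇒o%n%m≡o%m 4 12 x (divides 3 refl)))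
                                          (χ₃-cong {x % 12} {x} (m∣n⇒o%n%m≡o%m 3 12 x (divides 4 refl))) ⟩
  χ₄ x ⊛ χ₃ x                ∎
  where open ≡-Reasoning

3∣x⇒χ₁₂≡nil : ∀ {x} → 3 ∣ x → χ₁₂ x ≡ nil
3∣x⇒χ₁₂≡nil {x} 3∣x =
  trans (χ₁₂≡χ₄⊛χ₃ x) (trans (cong (χ₄ x ⊛_) (χ₃-cong {x} {0} (n∣m⇒m%n≡0 x 3 3∣x))) (⊛-zeroʳ (χ₄ x)))

χ₄-periodic : ∀ j m c → χ₄ (j * (4 * m) + c) ≡ χ₄ c
χ₄-periodic j m c = χ₄-cong {j * (4 * m) + c} {c} (trans (cong (_% 4) (lemma j m c)) ([m+kn]%n≡m%n c (j * m) 4))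
  where
  lemma : ∀ j m c → j * (4 * m) + c ≡ c + j * m * 4
  lemma = solve-∀

χ₄-odd : ∀ {x} → Odd x → χ₄ x ≢ nil
χ₄-odd {x} x-odd χ₄x≡nil =
  odd⇒2∤ x-odd (∣n∣m%n⇒∣m (divides 2 refl) (even-residue (x % 4) (m%n<n x 4) (trans (χ₄-% x) χ₄x≡nil)))
  where
  even-residue : ∀ r → r < 4 → χ₄ r ≡ nil → 2 ∣ r
  even-residue 0 _ _  = 2 ∣0
  even-residue 1 _ ()
  even-residue 2 _ _  = ∣-refl
  even-residue 3 _ ()
  even-residue (suc (suc (suc (suc _)))) (s≤s (s≤s (s≤s (s≤s ())))) _

χ₄-neg-residue : ∀ r r′ → r < 4 → r′ < 4 → (r + r′) % 4 ≡ 0 → χ₄ r′ ≡ minus ⊛ χ₄ r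
χ₄-neg-residue 0 0 _ _ _  = refl
χ₄-neg-residue 0 1 _ _ ()
χ₄-neg-residue 0 2 _ _ ()
χ₄-neg-residue 0 3 _ _ ()
χ₄-neg-residue 1 0 _ _ ()
χ₄-neg-residue 1 1 _ _ ()
χ₄-neg-residue 1 2 _ _ ()
χ₄-neg-residue 1 3 _ _ _  = refl
χ₄-neg-residue 2 0 _ _ ()
χ₄-neg-residue 2 1 _ _ ()
χ₄-neg-residue 2 2 _ _ _  = refl
χ₄-neg-residue 2 3 _ _ ()
χ₄-neg-residue 3 0 _ _ ()
χ₄-neg-residue 3 1 _ _ _  = refl
χ₄-neg-residue 3 2 _ _ ()
χ₄-neg-residue 3 3 _ _ ()
χ₄-neg-residue (suc (suc (suc (suc _)))) _ (s≤s (s≤s (s≤s (s≤s ())))) _ _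
χ₄-neg-residue _ (suc (suc (suc (suc _)))) _ (s≤s (s≤s (s≤s (s≤s ())))) _

χ₄-neg : ∀ {c c′} → 4 ∣ c + c′ → χ₄ c′ ≡ minus ⊛ χ₄ c
χ₄-neg {c} {c′} 4∣c+c′ = begin
  χ₄ c′               ≡⟨ χ₄-% c′ ⟨
  χ₄ (c′ % 4)         ≡⟨ χ₄-neg-residue (c % 4) (c′ % 4) (m%n<n c 4) (m%n<n c′ 4) residues-sum ⟩
  minus ⊛ χ₄ (c % 4)  ≡⟨ cong (minus ⊛_) (χ₄-% c) ⟩
  minus ⊛ χ₄ c        ∎
  where
  open ≡-Reasoning
  residues-sum : (c % 4 + c′ % 4) % 4 ≡ 0
  residues-sum = trans (sym (%-distribˡ-+ c c′ 4)) (n∣m⇒m%n≡0 (c + c′) 4 4∣c+c′)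

-- Powers and finite sums in a commutative ring

module RingProperties {c ℓ} (R : CommutativeRing c ℓ) where

  open CommutativeRing R
    renaming (_+_ to _+ᴿ_; _*_ to _*ᴿ_; refl to ≈-refl; sym to ≈-sym; trans to ≈-trans; reflexive to ≈-reflexive)
  open import Algebra.Properties.Ring ring
    using ( -‿involutive; -0#≈0#; -‿distribʳ-*; -‿+-comm; ⁻¹-anti-homo‿-; +-cancelˡ
          ; x∙y⁻¹≈ε⇒x≈y; [y-z]x≈yx-zx; x[y-z]≈xy-xz )
  open import Algebra.Properties.CommutativeSemigroup *-commutativeSemigroup
    using () renaming (interchange to *-interchange)
  open import Algebra.Properties.CommutativeSemigroup +-commutativeSemigroup
    using () renaming (interchange to +-interchange)
  open import Relation.Binary.Reasoning.Setoid setoid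

  pow-+ : ∀ x m n → pow R x (m + n) ≈ pow R x m *ᴿ pow R x n
  pow-+ x zero    n = ≈-sym (*-identityˡ _)
  pow-+ x (suc m) n = ≈-trans (*-congˡ (pow-+ x m n)) (≈-sym (*-assoc _ _ _))

  pow-* : ∀ x m n → pow R x (n * m) ≈ pow R (pow R x m) n
  pow-* x m zero    = ≈-refl
  pow-* x m (suc n) = ≈-trans (pow-+ x m (n * m)) (*-congˡ (pow-* x m n))

  pow-congˡ : ∀ {x y} n → x ≈ y → pow R x n ≈ pow R y n
  pow-congˡ zero    _   = ≈-refl
  pow-congˡ (suc n) x≈y = *-cong x≈y (pow-congˡ n x≈y)

  pow-distrib-* : ∀ x y n → pow R (x *ᴿ y) n ≈ pow R x n *ᴿ pow R y n
  pow-distrib-* x y zero    = ≈-sym (*-identityˡ 1#)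
  pow-distrib-* x y (suc n) = ≈-trans (*-congˡ (pow-distrib-* x y n)) (*-interchange x y _ _)

  pow-1# : ∀ n → pow R 1# n ≈ 1#
  pow-1# zero    = ≈-refl
  pow-1# (suc n) = ≈-trans (*-identityˡ _) (pow-1# n)

  pow-∣ : ∀ x m → pow R x m ≈ 1# → ∀ {d} → m ∣ d → pow R x d ≈ 1#
  pow-∣ x m xᵐ≈1 (divides q refl) = ≈-trans (pow-* x m q) (≈-trans (pow-congˡ q xᵐ≈1) (pow-1# q))

  pow-periodic : ∀ x m → pow R x m ≈ 1# → ∀ j c → pow R x (j * m + c) ≈ pow R x c
  pow-periodic x m xᵐ≈1 j c =
    ≈-trans (pow-+ x (j * m) c) (≈-trans (*-congʳ (pow-∣ x m xᵐ≈1 (n∣m*n j))) (*-identityˡ _))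

  pow-[xᵐ*x] : ∀ x m e → pow R (pow R x m *ᴿ x) e ≈ pow R x (e * (1 + m))
  pow-[xᵐ*x] x m e = begin
    pow R (pow R x m *ᴿ x) e          ≈⟨ pow-distrib-* (pow R x m) x e ⟩
    pow R (pow R x m) e *ᴿ pow R x e  ≈⟨ *-congʳ (pow-* x m e) ⟨
    pow R x (e * m) *ᴿ pow R x e      ≈⟨ pow-+ x (e * m) e ⟨
    pow R x (e * m + e)               ≡⟨ cong (pow R x) (lemma e m) ⟩
    pow R x (e * (1 + m))             ∎
    where
    lemma : ∀ e m → e * m + e ≡ e * (1 + m)
    lemma = solve-∀

  primitiveRoot-order : ∀ {m ζ} .{{_ : NonZero m}} → PrimitiveRoot R m ζ → ∀ d → pow R ζ d ≈ 1# → m ∣ d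
  primitiveRoot-order {m} {ζ} (ζᵐ≈1 , minimal) d ζᵈ≈1 with d % m ℕ.≟ 0
  ... | yes d%m≡0 = m%n≡0⇒n∣m d m d%m≡0
  ... | no  d%m≢0 = contradiction (≈-trans (≈-sym reduce) ζᵈ≈1) (minimal (d % m) (ℕ.n≢0⇒n>0 d%m≢0) (m%n<n d m))
    where
    reduce : pow R ζ d ≈ pow R ζ (d % m)
    reduce = ≈-trans (≈-reflexive (cong (pow R ζ) (trans (m≡m%n+[m/n]*n d m) (ℕ.+-comm (d % m) _))))
                     (pow-periodic ζ m ζᵐ≈1 (d / m) (d % m))

  ∑ : ℕ → (ℕ → Carrier) → Carrier
  ∑ zero    f = 0#
  ∑ (suc n) f = f 0 +ᴿ ∑ n (f ∘ suc)

  syntax ∑ n (λ i → e) = ∑[ i < n ] e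

  foldr-applyUpTo : ∀ f n → foldr _+ᴿ_ 0# (applyUpTo f n) ≡ ∑ n f
  foldr-applyUpTo f zero    = refl
  foldr-applyUpTo f (suc n) = cong (f 0 +ᴿ_) (foldr-applyUpTo (f ∘ suc) n)

  ∑-cong : ∀ n {f g} → (∀ i → i < n → f i ≈ g i) → ∑ n f ≈ ∑ n g
  ∑-cong zero    f≈g = ≈-refl
  ∑-cong (suc n) f≈g = +-cong (f≈g 0 (s≤s z≤n)) (∑-cong n (λ i i<n → f≈g (suc i) (s≤s i<n)))

  ∑-zero : ∀ n {f} → (∀ i → i < n → f i ≈ 0#) → ∑ n f ≈ 0#
  ∑-zero zero    f≈0 = ≈-refl
  ∑-zero (suc n) f≈0 =
    ≈-trans (+-cong (f≈0 0 (s≤s z≤n)) (∑-zero n (λ i i<n → f≈0 (suc i) (s≤s i<n)))) (+-identityˡ 0#)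

  ∑-distrib-+ : ∀ n f g → ∑[ i < n ] (f i +ᴿ g i) ≈ ∑ n f +ᴿ ∑ n g
  ∑-distrib-+ zero    f g = ≈-sym (+-identityˡ 0#)
  ∑-distrib-+ (suc n) f g = ≈-trans (+-congˡ (∑-distrib-+ n (f ∘ suc) (g ∘ suc))) (+-interchange _ _ _ _)

  ∑-distrib-neg : ∀ n f → ∑[ i < n ] (- f i) ≈ - ∑ n f
  ∑-distrib-neg zero    f = ≈-sym -0#≈0#
  ∑-distrib-neg (suc n) f = ≈-trans (+-congˡ (∑-distrib-neg n (f ∘ suc))) (-‿+-comm _ _)

  *-distribˡ-∑ : ∀ n x f → x *ᴿ ∑ n f ≈ ∑[ i < n ] (x *ᴿ f i)
  *-distribˡ-∑ zero    x f = zeroʳ x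
  *-distribˡ-∑ (suc n) x f = ≈-trans (distribˡ x _ _) (+-congˡ (*-distribˡ-∑ n x (f ∘ suc)))

  ∑-const : ∀ n x → ∑[ i < n ] x ≈ cast R n *ᴿ x
  ∑-const zero    x = ≈-sym (zeroˡ x)
  ∑-const (suc n) x = ≈-trans (+-cong (≈-sym (*-identityˡ x)) (∑-const n x)) (≈-sym (distribʳ x 1# _))

  ∑-last : ∀ n f → ∑ (suc n) f ≈ ∑ n f +ᴿ f n
  ∑-last zero    f = +-comm _ _
  ∑-last (suc n) f = ≈-trans (+-congˡ (∑-last n (f ∘ suc))) (≈-sym (+-assoc _ _ _))

  ∑-split : ∀ m n f → ∑ (m + n) f ≈ ∑ m f +ᴿ ∑[ i < n ] f (m + i)
  ∑-split zero    n f = ≈-sym (+-identityˡ _)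
  ∑-split (suc m) n f = ≈-trans (+-congˡ (∑-split m n (f ∘ suc))) (≈-sym (+-assoc _ _ _))

  ∑-blocks : ∀ m k f → ∑ (m * k) f ≈ ∑[ j < m ] ∑[ i < k ] f (j * k + i)
  ∑-blocks zero    k f = ≈-refl
  ∑-blocks (suc m) k f = ≈-trans (∑-split k (m * k) f) (+-congˡ (≈-trans (∑-blocks m k (λ i → f (k + i)))
    (∑-cong m (λ j _ → ∑-cong k (λ i _ → ≈-reflexive (cong f (sym (ℕ.+-assoc k (j * k) i))))))))

  ∑-comm : ∀ m n (f : ℕ → ℕ → Carrier) → ∑[ j < m ] ∑[ i < n ] f j i ≈ ∑[ i < n ] ∑[ j < m ] f j i
  ∑-comm zero    n f = ≈-sym (∑-zero n (λ _ _ → ≈-refl))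
  ∑-comm (suc m) n f =
    ≈-trans (+-congˡ (∑-comm m n (f ∘ suc))) (≈-sym (∑-distrib-+ n (f 0) (λ i → ∑[ j < m ] f (suc j) i)))

  ∑-single : ∀ n {p} f → p < n → (∀ i → i < n → i ≢ p → f i ≈ 0#) → ∑ n f ≈ f p
  ∑-single (suc n) {zero}  f _         f≈0 =
    ≈-trans (+-congˡ (∑-zero n (λ i i<n → f≈0 (suc i) (s≤s i<n) λ ()))) (+-identityʳ _)
  ∑-single (suc n) {suc p} f (s≤s p<n) f≈0 =
    ≈-trans (+-congʳ (f≈0 0 (s≤s z≤n) λ ())) (≈-trans (+-identityˡ _)
      (∑-single n (f ∘ suc) p<n (λ i i<n i≢p → f≈0 (suc i) (s≤s i<n) (i≢p ∘ ℕ.suc-injective))))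

  ∑-pair : ∀ n {p q} f → p < n → q < n → p ≢ q → (∀ i → i < n → i ≢ p → i ≢ q → f i ≈ 0#) →
           ∑ n f ≈ f p +ᴿ f q
  ∑-pair (suc n) {zero}  {zero}  f _         _         p≢q _   = contradiction refl p≢q
  ∑-pair (suc n) {zero}  {suc q} f _         (s≤s q<n) _   f≈0 =
    +-congˡ (∑-single n (f ∘ suc) q<n (λ i i<n i≢q → f≈0 (suc i) (s≤s i<n) (λ ()) (i≢q ∘ ℕ.suc-injective)))
  ∑-pair (suc n) {suc p} {zero}  f (s≤s p<n) _         _   f≈0 =
    ≈-trans (+-congˡ (∑-single n (f ∘ suc) p<n (λ i i<n i≢p → f≈0 (suc i) (s≤s i<n) (i≢p ∘ ℕ.suc-injective) (λ ()))))
            (+-comm _ _)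
  ∑-pair (suc n) {suc p} {suc q} f (s≤s p<n) (s≤s q<n) p≢q f≈0 =
    ≈-trans (+-congʳ (f≈0 0 (s≤s z≤n) (λ ()) (λ ()))) (≈-trans (+-identityˡ _)
      (∑-pair n (f ∘ suc) p<n q<n (p≢q ∘ cong suc)
        (λ i i<n i≢p i≢q → f≈0 (suc i) (s≤s i<n) (i≢p ∘ ℕ.suc-injective) (i≢q ∘ ℕ.suc-injective))))

  ∑-residue-class : ∀ α β K → pow R α K ≈ 1# → ∀ n c →
                    ∑[ j < n ] (pow R α (j * K + c) - pow R β (j * K + c)) ≈
                    cast R n *ᴿ pow R α c - pow R β c *ᴿ ∑[ j < n ] pow R (pow R β K) j
  ∑-residue-class α β K αᴷ≈1 n c = begin
    ∑[ j < n ] (pow R α (j * K + c) - pow R β (j * K + c))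
      ≈⟨ ∑-cong n (λ j _ → +-cong (pow-periodic α K αᴷ≈1 j c) (-‿cong (βʲᴷ⁺ᶜ j))) ⟩
    ∑[ j < n ] (pow R α c - pow R β c *ᴿ σ j)
      ≈⟨ ∑-distrib-+ n (λ _ → pow R α c) (λ j → - (pow R β c *ᴿ σ j)) ⟩
    ∑[ j < n ] pow R α c +ᴿ ∑[ j < n ] (- (pow R β c *ᴿ σ j))
      ≈⟨ +-cong (∑-const n (pow R α c)) (∑-distrib-neg n _) ⟩
    cast R n *ᴿ pow R α c - ∑[ j < n ] (pow R β c *ᴿ σ j)
      ≈⟨ +-congˡ (-‿cong (*-distribˡ-∑ n (pow R β c) σ)) ⟨
    cast R n *ᴿ pow R α c - pow R β c *ᴿ ∑ n σ
      ∎
    where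
    σ : ℕ → Carrier
    σ = pow R (pow R β K)
    βʲᴷ⁺ᶜ : ∀ j → pow R β (j * K + c) ≈ pow R β c *ᴿ σ j
    βʲᴷ⁺ᶜ j = ≈-trans (pow-+ β (j * K) c) (≈-trans (*-congʳ (pow-* β K j)) (*-comm _ _))

  signed-cong : ∀ s {x y} → x ≈ y → signed R s x ≈ signed R s y
  signed-cong plus  x≈y = x≈y
  signed-cong minus x≈y = -‿cong x≈y
  signed-cong nil   _   = ≈-refl

  *-signed : ∀ s x y → x *ᴿ signed R s y ≈ signed R s (x *ᴿ y)
  *-signed plus  x y = ≈-refl
  *-signed minus x y = ≈-sym (-‿distribʳ-* x y)
  *-signed nil   x y = zeroʳ x

  signed-⊛ : ∀ s t x → signed R (s ⊛ t) x ≈ signed R s (signed R t x)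
  signed-⊛ plus  t     x = ≈-refl
  signed-⊛ minus plus  x = ≈-refl
  signed-⊛ minus minus x = ≈-sym (-‿involutive x)
  signed-⊛ minus nil   x = ≈-sym -0#≈0#
  signed-⊛ nil   t     x = ≈-refl

  ∑-signed : ∀ n s f → ∑[ i < n ] signed R s (f i) ≈ signed R s (∑ n f)
  ∑-signed n plus  f = ≈-refl
  ∑-signed n minus f = ∑-distrib-neg n f
  ∑-signed n nil   f = ∑-zero n (λ _ _ → ≈-refl)

  signed-antipodal : ∀ {s x y} → s ≢ nil → signed R s x +ᴿ signed R (minus ⊛ s) y ≈ 0# → x ≈ y
  signed-antipodal {plus}  _     x-y≈0 = x∙y⁻¹≈ε⇒x≈y _ _ x-y≈0
  signed-antipodal {minus} _     y-x≈0 = ≈-sym (x∙y⁻¹≈ε⇒x≈y _ _ (≈-trans (+-comm _ _) y-x≈0))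
  signed-antipodal {nil}   s≢nil _     = contradiction refl s≢nil

  zero-product : IsField R → ∀ {x y} → ¬ x ≈ 0# → x *ᴿ y ≈ 0# → y ≈ 0#
  zero-product (_ , invertible) {x} {y} x≉0 xy≈0 = begin
    y                ≈⟨ *-identityˡ y ⟨
    1# *ᴿ y          ≈⟨ *-congʳ (≈-trans (*-comm x⁻¹ x) xx⁻¹≈1) ⟨
    (x⁻¹ *ᴿ x) *ᴿ y  ≈⟨ *-assoc x⁻¹ x y ⟩
    x⁻¹ *ᴿ (x *ᴿ y)  ≈⟨ *-congˡ xy≈0 ⟩
    x⁻¹ *ᴿ 0#        ≈⟨ zeroʳ x⁻¹ ⟩
    0#               ∎
    where
    x⁻¹ = proj₁ (invertible x x≉0)
    xx⁻¹≈1 = proj₂ (invertible x x≉0)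

  *-cancelˡ-nonzero : IsField R → ∀ {x y z} → ¬ x ≈ 0# → x *ᴿ y ≈ x *ᴿ z → y ≈ z
  *-cancelˡ-nonzero isField {x} {y} {z} x≉0 xy≈xz = x∙y⁻¹≈ε⇒x≈y y z (zero-product isField x≉0 (begin
    x *ᴿ (y - z)     ≈⟨ x[y-z]≈xy-xz x y z ⟩
    x *ᴿ y - x *ᴿ z  ≈⟨ +-congʳ xy≈xz ⟩
    x *ᴿ z - x *ᴿ z  ≈⟨ -‿inverseʳ _ ⟩
    0#               ∎))

  -- Multiplication by σ permutes the powers σ⁰, …, σⁿ⁻¹, so (σ − 1) annihilates their sum.
  ∑-pow-root-of-unity : IsField R → ∀ {σ} n → pow R σ n ≈ 1# → ¬ σ ≈ 1# → ∑[ j < n ] pow R σ j ≈ 0#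
  ∑-pow-root-of-unity isField {σ} n σⁿ≈1 σ≉1 = zero-product isField (σ≉1 ∘ x∙y⁻¹≈ε⇒x≈y σ 1#) (begin
    (σ - 1#) *ᴿ S     ≈⟨ [y-z]x≈yx-zx S σ 1# ⟩
    σ *ᴿ S - 1# *ᴿ S  ≈⟨ +-cong σS≈S (-‿cong (*-identityˡ S)) ⟩
    S - S             ≈⟨ -‿inverseʳ S ⟩
    0#                ∎)
    where
    S = ∑[ j < n ] pow R σ j
    σS≈S : σ *ᴿ S ≈ S
    σS≈S = +-cancelˡ 1# _ _ (begin
      1# +ᴿ σ *ᴿ S         ≈⟨ +-congˡ (*-distribˡ-∑ n σ (pow R σ)) ⟩
      ∑ (suc n) (pow R σ)  ≈⟨ ∑-last n (pow R σ) ⟩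
      S +ᴿ pow R σ n       ≈⟨ +-comm S _ ⟩
      pow R σ n +ᴿ S       ≈⟨ +-congʳ σⁿ≈1 ⟩
      1# +ᴿ S              ∎)

  module _ {ω : Carrier} (ω³≈1 : pow R ω 3 ≈ 1#) where

    private
      ω² = pow R ω 2

    cubic-character-residue : ∀ r → r < 3 → ∀ y →
                              (ω - ω²) *ᴿ signed R (χ₃ r) y ≈ pow R ω r *ᴿ y - pow R ω² r *ᴿ y
    cubic-character-residue 0 _ y = ≈-trans (zeroʳ _) (≈-sym (-‿inverseʳ (1# *ᴿ y)))
    cubic-character-residue 1 _ y =
      ≈-trans ([y-z]x≈yx-zx y ω ω²) (≈-sym (+-cong (*-congʳ (*-identityʳ ω)) (-‿cong (*-congʳ (*-identityʳ ω²)))))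
    cubic-character-residue 2 _ y = begin
      (ω - ω²) *ᴿ - y            ≈⟨ -‿distribʳ-* _ y ⟨
      - ((ω - ω²) *ᴿ y)          ≈⟨ -‿cong ([y-z]x≈yx-zx y ω ω²) ⟩
      - (ω *ᴿ y - ω² *ᴿ y)       ≈⟨ ⁻¹-anti-homo‿- _ _ ⟩
      ω² *ᴿ y - ω *ᴿ y           ≈⟨ +-congˡ (-‿cong (*-congʳ ω≈ω²²)) ⟩
      ω² *ᴿ y - pow R ω² 2 *ᴿ y  ∎
      where
      ω≈ω²² : ω ≈ pow R ω² 2
      ω≈ω²² = begin
        ω                ≈⟨ *-identityʳ ω ⟨
        pow R ω 1        ≈⟨ pow-periodic ω 3 ω³≈1 1 1 ⟨
        pow R ω (2 * 2)  ≈⟨ pow-* ω 2 2 ⟩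
        pow R ω² 2       ∎
    cubic-character-residue (suc (suc (suc _))) (s≤s (s≤s (s≤s ()))) _

    cubic-character : ∀ x y → (ω - ω²) *ᴿ signed R (χ₃ x) y ≈ pow R ω x *ᴿ y - pow R ω² x *ᴿ y
    cubic-character x y = begin
      (ω - ω²) *ᴿ signed R (χ₃ x) y     ≡⟨ cong (λ s → (ω - ω²) *ᴿ signed R s y) (χ₃-% x) ⟨
      (ω - ω²) *ᴿ signed R (χ₃ r) y     ≈⟨ cubic-character-residue r (m%n<n x 3) y ⟩
      pow R ω r *ᴿ y - pow R ω² r *ᴿ y  ≈⟨ +-cong (*-congʳ (reduce ω³≈1)) (-‿cong (*-congʳ (reduce ω²³≈1))) ⟨
      pow R ω x *ᴿ y - pow R ω² x *ᴿ y  ∎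
      where
      r = x % 3
      x≡ : x ≡ x / 3 * 3 + r
      x≡ = trans (m≡m%n+[m/n]*n x 3) (ℕ.+-comm r _)
      reduce : ∀ {w} → pow R w 3 ≈ 1# → pow R w x ≈ pow R w r
      reduce {w} w³≈1 = ≈-trans (≈-reflexive (cong (pow R w) x≡)) (pow-periodic w 3 w³≈1 (x / 3) r)
      ω²³≈1 : pow R ω² 3 ≈ 1#
      ω²³≈1 = ≈-trans (≈-sym (pow-* ω 2 3)) (pow-periodic ω 3 ω³≈1 2 0)

-- The sum S_{2^a}(n + 1)

module _ {c ℓ} (R : CommutativeRing c ℓ) (isField : IsField R) (charZero : CharZero R)
         (ζ : CommutativeRing.Carrier R) (a : ℕ) (ζ-primitive : PrimitiveRoot R (12 * 2 ^ a) ζ) (n : ℕ) where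

  open CommutativeRing R
    renaming (_+_ to _+ᴿ_; _*_ to _*ᴿ_; refl to ≈-refl; sym to ≈-sym; trans to ≈-trans; reflexive to ≈-reflexive)
  open import Algebra.Properties.Ring ring using (-0#≈0#)
  open RingProperties R
  open import Relation.Binary.Reasoning.Setoid setoid

  private
    k K N L M : ℕ
    k = 2 ^ a
    K = 4 * k
    N = 12 * k
    L = 2 * (K * K)
    M = 23 + 24 * n

    instance
      k-nonZero : NonZero k
      k-nonZero = ℕ.m^n≢0 2 a
      K-nonZero : NonZero K
      K-nonZero = ℕ.m*n≢0 4 k
      N-nonZero : NonZero N
      N-nonZero = ℕ.m*n≢0 12 k

    8∣1+M : 8 ∣ 1 + M
    8∣1+M = divides (3 + 3 * n) (lemma n)
      where
      lemma : ∀ n → 1 + (23 + 24 * n) ≡ (3 + 3 * n) * 8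
      lemma = solve-∀

    3∣1+M : 3 ∣ 1 + M
    3∣1+M = divides (8 + 8 * n) (lemma n)
      where
      lemma : ∀ n → 1 + (23 + 24 * n) ≡ (8 + 8 * n) * 3
      lemma = solve-∀

    2∤M : 2 ∤ M
    2∤M = 8∣1+M⇒2∤M 8∣1+M

    3∤K : 3 ∤ K
    3∤K 3∣K = 3∤2^ (2 + a) (subst (3 ∣_) (lemma k) 3∣K)
      where
      lemma : ∀ k → 4 * k ≡ 2 * (2 * k)
      lemma = solve-∀

    N∣3*L : N ∣ 3 * L
    N∣3*L = divides (8 * k) (lemma k)
      where
      lemma : ∀ k → 3 * (2 * (4 * k * (4 * k))) ≡ 8 * k * (12 * k)
      lemma = solve-∀

    N∣K*[1+L] : N ∣ K * (1 + L)
    N∣K*[1+L] with 3∤x⇒3∣1+2*x*x 3∤K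
    ... | divides q 1+L≡ = divides q (trans (cong (K *_) 1+L≡) (lemma q k))
      where
      lemma : ∀ q k → 4 * k * (q * 3) ≡ q * (12 * k)
      lemma = solve-∀

    N∣6*K*[1+2L] : N ∣ 6 * K * (1 + 2 * L)
    N∣6*K*[1+2L] = divides (2 * (1 + 2 * L)) (lemma k (1 + 2 * L))
      where
      lemma : ∀ k y → 6 * (4 * k) * y ≡ 2 * y * (12 * k)
      lemma = solve-∀

    N∤K*[1+2L] : ¬ N ∣ K * (1 + 2 * L)
    N∤K*[1+2L] N∣ = 3∤x⇒3∤1+4*x*x 3∤K (*-cancelˡ-∣ K (subst (_∣ K * (1 + 2 * L)) (lemma k) N∣))
      where
      lemma : ∀ k → 12 * k ≡ 4 * k * 3
      lemma = solve-∀

    N∤[c+c]*[1+L] : ∀ {c} → Odd c → ¬ N ∣ (c + c) * (1 + L)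
    N∤[c+c]*[1+L] c-odd N∣ = 4∤[x+x]*y c-odd (K * K , refl) (∣-trans (divides (3 * k) (lemma k)) N∣)
      where
      lemma : ∀ k → 12 * k ≡ 3 * k * 4
      lemma = solve-∀

    ζ-order : ∀ d → pow R ζ d ≈ 1# → N ∣ d
    ζ-order = primitiveRoot-order ζ-primitive

    ζ-∣ : ∀ {d} → N ∣ d → pow R ζ d ≈ 1#
    ζ-∣ = pow-∣ ζ N (proj₁ ζ-primitive)

    ω α β σ D : Carrier
    ω = pow R ζ L
    α = ω *ᴿ ζ
    β = pow R ω 2 *ᴿ ζ
    σ = pow R β K
    D = ω - pow R ω 2

    ω³≈1 : pow R ω 3 ≈ 1#
    ω³≈1 = ≈-trans (≈-sym (pow-* ζ L 3)) (ζ-∣ N∣3*L)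

    pow-α : ∀ e → pow R α e ≈ pow R ζ (e * (1 + L))
    pow-α = pow-[xᵐ*x] ζ L

    pow-β : ∀ e → pow R β e ≈ pow R ζ (e * (1 + 2 * L))
    pow-β e = ≈-trans (pow-congˡ e (*-congʳ (≈-sym (pow-* ζ L 2)))) (pow-[xᵐ*x] ζ (2 * L) e)

    αᴷ≈1 : pow R α K ≈ 1#
    αᴷ≈1 = ≈-trans (pow-α K) (ζ-∣ N∣K*[1+L])

    ∑σʲ≈0 : ∑[ j < 6 ] pow R σ j ≈ 0#
    ∑σʲ≈0 = ∑-pow-root-of-unity isField 6 σ⁶≈1 σ≉1
      where
      σ⁶≈1 : pow R σ 6 ≈ 1#
      σ⁶≈1 = ≈-trans (≈-sym (pow-* β K 6)) (≈-trans (pow-β (6 * K)) (ζ-∣ N∣6*K*[1+2L]))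
      σ≉1 : ¬ σ ≈ 1#
      σ≉1 σ≈1 = N∤K*[1+2L] (ζ-order _ (≈-trans (≈-sym (pow-β K)) σ≈1))

    Root : ℕ → Set
    Root = SqrtNeg (8 * k) M

    T : ℕ → Carrier
    T = term R k (suc n) ζ

    x*x+24*[1+n]∸1≡x*x+M : ∀ x → x * x + 24 * suc n ∸ 1 ≡ x * x + M
    x*x+24*[1+n]∸1≡x*x+M x = cong (_∸ 1) (lemma x n)
      where
      lemma : ∀ x n → x * x + 24 * suc n ≡ 1 + (x * x + (23 + 24 * n))
      lemma = solve-∀

    term-yes : ∀ x → 24 * k ∣ x * x + M → T x ≈ signed R (χ₁₂ x) (pow R ζ x)
    term-yes x 24z∣ with 24 * k ∣? x * x + 24 * suc n ∸ 1
    ... | yes _    = ≈-refl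
    ... | no  24z∤ = contradiction (subst (24 * k ∣_) (sym (x*x+24*[1+n]∸1≡x*x+M x)) 24z∣) 24z∤

    term-no : ∀ x → 24 * k ∤ x * x + M → T x ≈ 0#
    term-no x 24z∤ with 24 * k ∣? x * x + 24 * suc n ∸ 1
    ... | yes 24z∣ = contradiction (subst (24 * k ∣_) (x*x+24*[1+n]∸1≡x*x+M x) 24z∣) 24z∤
    ... | no  _    = ≈-refl

    -- A root modulo 8·2^a divisible by 3 contributes no term, but then χ₁₂ x vanishes as well.
    term-root : ∀ {x} → Root x → T x ≈ signed R (χ₁₂ x) (pow R ζ x)
    term-root {x} root with 3 ∣? x
    ... | no  3∤x = term-yes x (3∣∧8*2^a∣⇒24*2^a∣ a (3∤x⇒3∣x*x+M 3∣1+M 3∤x) root)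
    ... | yes 3∣x = begin
      T x                           ≈⟨ term-no x (3∣x⇒3∤x*x+M 3∣1+M 3∣x ∘ ∣-trans (divides (8 * k) (lemma k))) ⟩
      0#                            ≡⟨ cong (λ s → signed R s (pow R ζ x)) (3∣x⇒χ₁₂≡nil 3∣x) ⟨
      signed R (χ₁₂ x) (pow R ζ x)  ∎
      where
      lemma : ∀ k → 24 * k ≡ 8 * k * 3
      lemma = solve-∀

    term-nonroot : ∀ {x} → ¬ Root x → T x ≈ 0#
    term-nonroot {x} ¬root = term-no x (¬root ∘ ∣-trans (divides 3 (lemma k)))
      where
      lemma : ∀ k → 24 * k ≡ 3 * (8 * k)
      lemma = solve-∀

    D*term-root : ∀ {x} → Root x → D *ᴿ T x ≈ signed R (χ₄ x) (pow R α x - pow R β x)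
    D*term-root {x} root = begin
      D *ᴿ T x                                                ≈⟨ *-congˡ (term-root root) ⟩
      D *ᴿ signed R (χ₁₂ x) (pow R ζ x)                       ≡⟨ cong (λ s → D *ᴿ signed R s (pow R ζ x)) (χ₁₂≡χ₄⊛χ₃ x) ⟩
      D *ᴿ signed R (χ₄ x ⊛ χ₃ x) (pow R ζ x)                 ≈⟨ *-congˡ (signed-⊛ (χ₄ x) (χ₃ x) _) ⟩
      D *ᴿ signed R (χ₄ x) (signed R (χ₃ x) (pow R ζ x))      ≈⟨ *-signed (χ₄ x) D _ ⟩
      signed R (χ₄ x) (D *ᴿ signed R (χ₃ x) (pow R ζ x))      ≈⟨ signed-cong (χ₄ x) (cubic-character ω³≈1 x (pow R ζ x)) ⟩
      signed R (χ₄ x) (pow R ω x *ᴿ pow R ζ x - pow R (pow R ω 2) x *ᴿ pow R ζ x)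
        ≈⟨ signed-cong (χ₄ x) (+-cong (pow-distrib-* ω ζ x) (-‿cong (pow-distrib-* (pow R ω 2) ζ x))) ⟨
      signed R (χ₄ x) (pow R α x - pow R β x)                 ∎

    classSum : ℕ → Carrier
    classSum c = ∑[ j < 6 ] (D *ᴿ T (j * K + c))

    classSum-nonroot : ∀ {c} → ¬ Root c → classSum c ≈ 0#
    classSum-nonroot {c} ¬root = ∑-zero 6 (λ j _ →
      ≈-trans (*-congˡ (term-nonroot {j * K + c} (¬root ∘ Equivalence.to (sqrtNeg-shift a j c)))) (zeroʳ D))

    classSum-root : ∀ {c} → Root c → classSum c ≈ signed R (χ₄ c) (cast R 6 *ᴿ pow R α c)
    classSum-root {c} root = begin
      ∑[ j < 6 ] (D *ᴿ T (j * K + c))                             ≈⟨ ∑-cong 6 (λ j _ → shifted j) ⟩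
      ∑[ j < 6 ] signed R (χ₄ c) (f j)                            ≈⟨ ∑-signed 6 (χ₄ c) f ⟩
      signed R (χ₄ c) (∑ 6 f)                                     ≈⟨ signed-cong (χ₄ c) (∑-residue-class α β K αᴷ≈1 6 c) ⟩
      signed R (χ₄ c) (cast R 6 *ᴿ pow R α c - pow R β c *ᴿ ∑[ j < 6 ] pow R σ j)
        ≈⟨ signed-cong (χ₄ c) (+-congˡ (-‿cong (*-congˡ ∑σʲ≈0))) ⟩
      signed R (χ₄ c) (cast R 6 *ᴿ pow R α c - pow R β c *ᴿ 0#)
        ≈⟨ signed-cong (χ₄ c) (+-congˡ (≈-trans (-‿cong (zeroʳ _)) -0#≈0#)) ⟩
      signed R (χ₄ c) (cast R 6 *ᴿ pow R α c +ᴿ 0#)               ≈⟨ signed-cong (χ₄ c) (+-identityʳ _) ⟩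
      signed R (χ₄ c) (cast R 6 *ᴿ pow R α c)                     ∎
      where
      f : ℕ → Carrier
      f j = pow R α (j * K + c) - pow R β (j * K + c)
      shifted : ∀ j → D *ᴿ T (j * K + c) ≈ signed R (χ₄ c) (f j)
      shifted j = ≈-trans (D*term-root (Equivalence.from (sqrtNeg-shift a j c) root))
                          (≈-reflexive (cong (λ s → signed R s (f j)) (χ₄-periodic j k c)))

    D*Ssum≈classSum+classSum : ∀ {c₀ c₁} → c₀ < K → c₀ + c₁ ≡ K → Root c₀ →
                               D *ᴿ Ssum R k (suc n) ζ ≈ classSum c₀ +ᴿ classSum c₁
    D*Ssum≈classSum+classSum {c₀} {c₁} c₀<K c₀+c₁≡K root₀ = begin
      D *ᴿ Ssum R k (suc n) ζ
        ≡⟨ cong (D *ᴿ_) (trans (cong (foldr _+ᴿ_ 0#) (map-applyUpTo id T (24 * k))) (foldr-applyUpTo T (24 * k))) ⟩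
      D *ᴿ ∑ (24 * k) T                           ≈⟨ *-distribˡ-∑ (24 * k) D T ⟩
      ∑[ x < 24 * k ] (D *ᴿ T x)                  ≡⟨ cong (λ m → ∑[ x < m ] (D *ᴿ T x)) (lemma k) ⟩
      ∑[ x < 6 * K ] (D *ᴿ T x)                   ≈⟨ ∑-blocks 6 K (λ x → D *ᴿ T x) ⟩
      ∑[ j < 6 ] ∑[ c < K ] (D *ᴿ T (j * K + c))  ≈⟨ ∑-comm 6 K (λ j c → D *ᴿ T (j * K + c)) ⟩
      ∑ K classSum                                ≈⟨ ∑-pair K classSum c₀<K c₁<K c₀≢c₁ elsewhere ⟩
      classSum c₀ +ᴿ classSum c₁                  ∎
      where
      lemma : ∀ k → 24 * k ≡ 6 * (4 * k)
      lemma = solve-∀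
      c₀-odd : Odd c₀
      c₀-odd = sqrtNeg-odd (2∣8*2^a a) 2∤M root₀
      c₁<K : c₁ < K
      c₁<K = subst (c₁ <_) c₀+c₁≡K (ℕ.m<n+m c₁ (subst (0 <_) (sym (proj₂ c₀-odd)) (s≤s z≤n)))
      c₀≢c₁ : c₀ ≢ c₁
      c₀≢c₁ refl =
        4∤[x+x]*y c₀-odd (0 , refl) (divides k (trans (ℕ.*-identityʳ (c₀ + c₀)) (trans c₀+c₁≡K (ℕ.*-comm 4 k))))
      elsewhere : ∀ c → c < K → c ≢ c₀ → c ≢ c₁ → classSum c ≈ 0#
      elsewhere c c<K c≢c₀ c≢c₁ = classSum-nonroot λ root →
        [ c≢c₀ , (λ c₀+c≡K → c≢c₁ (ℕ.+-cancelˡ-≡ c₀ c c₁ (trans c₀+c≡K (sym c₀+c₁≡K)))) ]′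
          (sqrtNeg-unique a 2∤M c₀<K c<K root₀ root)

    Ssum-nonzero-from-root : ∀ {c₀} → c₀ < K → Root c₀ → ¬ Ssum R k (suc n) ζ ≈ 0#
    Ssum-nonzero-from-root {c₀} c₀<K root₀ S≈0 =
      N∤[c+c]*[1+L] c₀-odd (ζ-order ((c₀ + c₀) * (1 + L)) (≈-trans (≈-sym (pow-α (c₀ + c₀))) α^[c₀+c₀]≈1))
      where
      c₀-odd : Odd c₀
      c₀-odd = sqrtNeg-odd (2∣8*2^a a) 2∤M root₀
      c₁ : ℕ
      c₁ = proj₁ (ℕ.m≤n⇒∃[o]m+o≡n (ℕ.<⇒≤ c₀<K))
      c₀+c₁≡K : c₀ + c₁ ≡ K
      c₀+c₁≡K = proj₂ (ℕ.m≤n⇒∃[o]m+o≡n (ℕ.<⇒≤ c₀<K))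
      6α^c₀ 6α^c₁ : Carrier
      6α^c₀ = cast R 6 *ᴿ pow R α c₀
      6α^c₁ = cast R 6 *ᴿ pow R α c₁
      signs-cancel : signed R (χ₄ c₀) 6α^c₀ +ᴿ signed R (minus ⊛ χ₄ c₀) 6α^c₁ ≈ 0#
      signs-cancel = begin
        signed R (χ₄ c₀) 6α^c₀ +ᴿ signed R (minus ⊛ χ₄ c₀) 6α^c₁
          ≡⟨ cong (λ s → signed R (χ₄ c₀) 6α^c₀ +ᴿ signed R s 6α^c₁)
                  (χ₄-neg {c₀} {c₁} (divides k (trans c₀+c₁≡K (ℕ.*-comm 4 k)))) ⟨
        signed R (χ₄ c₀) 6α^c₀ +ᴿ signed R (χ₄ c₁) 6α^c₁
          ≈⟨ +-cong (classSum-root root₀) (classSum-root (sqrtNeg-antipode a {c₀} {c₁} c₀+c₁≡K root₀)) ⟨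
        classSum c₀ +ᴿ classSum c₁  ≈⟨ D*Ssum≈classSum+classSum c₀<K c₀+c₁≡K root₀ ⟨
        D *ᴿ Ssum R k (suc n) ζ     ≈⟨ *-congˡ S≈0 ⟩
        D *ᴿ 0#                     ≈⟨ zeroʳ D ⟩
        0#                          ∎
      α^[c₀+c₀]≈1 : pow R α (c₀ + c₀) ≈ 1#
      α^[c₀+c₀]≈1 = begin
        pow R α (c₀ + c₀)         ≈⟨ pow-+ α c₀ c₀ ⟩
        pow R α c₀ *ᴿ pow R α c₀  ≈⟨ *-congˡ (*-cancelˡ-nonzero isField (charZero 5)
                                              (signed-antipodal (χ₄-odd c₀-odd) signs-cancel)) ⟩
        pow R α c₀ *ᴿ pow R α c₁  ≈⟨ pow-+ α c₀ c₁ ⟨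
        pow R α (c₀ + c₁)         ≡⟨ cong (pow R α) c₀+c₁≡K ⟩
        pow R α K                 ≈⟨ αᴷ≈1 ⟩
        1#                        ∎

  Ssum-nonzero : ¬ Ssum R (2 ^ a) (suc n) ζ ≈ 0#
  Ssum-nonzero = let _ , c₀<K , root₀ = sqrtNeg-exists 8∣1+M a in Ssum-nonzero-from-root c₀<K root₀

lemma3p1 : ∀ {c ℓ} (R : CommutativeRing c ℓ) → IsField R → CharZero R →
    (ζ : CommutativeRing.Carrier R) → (a : ℕ) → PrimitiveRoot R (12 * 2 ^ a) ζ →
    (n : ℕ) → 1 ≤ n →
    ¬ (CommutativeRing._≈_ R (Ssum R (2 ^ a) n ζ) (CommutativeRing.0# R))
lemma3p1 R isField charZero ζ a ζ-primitive zero    ()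
lemma3p1 R isField charZero ζ a ζ-primitive (suc n) _ = Ssum-nonzero R isField charZero ζ a ζ-primitive n
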